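{- Let $G$ be a finite simple graph whose vertex set $V(G)$ is totally ordered, and let $u\in V(G)$. Let $\mathbf{w}\in\mathcal{P}_u(G)$ with $u(\mathbf{w})=1$, and write $N_G(u,\mathbf{w})=\{u_1<\cdots<u_d\}$, where $d=|N_G(u,\mathbf{w})|$. Then there exist unique $\mathbf{w}_1,\dots,\mathbf{w}_d\in\mathcal{P}^{\emptyset}(G)$ such that: (i) $\mathbf{w}=\mathbf{w}_1\cdots\mathbf{w}_d\,u$; (ii) for each $1\le i\le d$, if $\mathbf{w}_i$ is not the empty word then $\mathrm{IA}(\mathbf{w}_i)=\{u_i\}$; (iii) for all $i<j$, the letter $u_i$ does not occur in $\mathbf{w}_j$.
   Context: $\mathcal{P}^{\emptyset}(G)$ denotes the partially commutative (Cartier–Foata) monoid of $G$: the monoid generated by the elements of $V(G)$ subject only to the relations $ab=ba$ for distinct $a,b\in V(G)$ not joined by an edge. Its elements are called words; the identity is the empty word, and $\mathcal{P}(G)$ is the set of non-empty words. For a word $\mathbf{w}$ and $v\in V(G)$, $v(\mathbf{w})$ is the number of occurrences of the letter $v$ in $\mathbf{w}$ (well defined on equivalence classes), and "$v$ occurs in $\mathbf{w}$" means $v(\mathbf{w})>0$. The initial alphabet $\mathrm{IA}(\mathbf{w})$ of a non-empty word $\mathbf{w}$ is the set of $v\in V(G)$ such that $\mathbf{w}=\mathbf{u}v$ for some $\mathbf{u}\in\mathcal{P}^{\emptyset}(G)$. For $S\subseteq V(G)$, $\mathcal{P}_S(G)=\{\mathbf{w}\in\mathcal{P}(G):\mathrm{IA}(\mathbf{w})\subseteq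 S\}$, and $\mathcal{P}_u(G)=\mathcal{P}_{\{u\}}(G)$. $N_G(u)$ is the set of neighbours of $u$ in $G$, and $N_G(u,\mathbf{w})=\{v\in N_G(u): v(\mathbf{w})>0\}$. -}

module Defs where

open import Data.Nat using (ℕ; zero; suc; _>_)
open import Data.Bool using (Bool; true; false; _∧_)
open import Data.Fin using (Fin; _<_)
open import Data.Fin.Properties using (_≟_)
open import Data.List using (List; []; _∷_; _++_; [_]; filterᵇ; length; lookup; concat)
open import Data.List using (allFin)
open import Data.Vec using (Vec; toList)
import Data.Vec as Vec
open import Data.Product using (Σ; ∃; _×_; _,_)
open import Relation.Nullary using (¬_; does)
open import Relation.Binary.PropositionalEquality using (_≡_; _≢_)
open import Function.Bundles using (_⇔_)

-- A finite simple graph on the totally ordered vertex set Fin n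
-- (ordered by the usual order of Fin n).
record SimpleGraph (n : ℕ) : Set where
  field
    adj    : Fin n → Fin n → Bool
    sym    : ∀ a b → adj a b ≡ adj b a
    irrefl : ∀ a → adj a a ≡ false
open SimpleGraph public

Word : ℕ → Set
Word n = List (Fin n)

-- Equivalence of representatives in the partially commutative monoid:
-- equivalence closure of swapping adjacent distinct non-adjacent letters.
data _∼[_]_ {n : ℕ} : Word n → SimpleGraph n → Word n → Set where
  ∼refl  : ∀ {G w} → w ∼[ G ] w
  ∼sym   : ∀ {G w v} → w ∼[ G ] v → v ∼[ G ] w
  ∼trans : ∀ {G w v x} → w ∼[ G ] v → v ∼[ G ] x → w ∼[ G ] x
  ∼swap  : ∀ {G} (p q : Word n) (a b : Fin n) → a ≢ b → adj G a b ≡ false →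
           (p ++ a ∷ b ∷ q) ∼[ G ] (p ++ b ∷ a ∷ q)

occ : ∀ {n} → Fin n → Word n → ℕ
occ v w = length (filterᵇ (λ x → does (v ≟ x)) w)

InIA : ∀ {n} → SimpleGraph n → Word n → Fin n → Set
InIA {n} G w v = Σ (Word n) λ p → w ∼[ G ] (p ++ [ v ])

NonEmpty : ∀ {n} → Word n → Set
NonEmpty w = ¬ (w ≡ [])

InPu : ∀ {n} → SimpleGraph n → Fin n → Word n → Set
InPu G u w = NonEmpty w × (∀ v → InIA G w v → v ≡ u)

Nbrs : ∀ {n} → SimpleGraph n → Fin n → Word n → List (Fin n)
Nbrs {n} G u w = filterᵇ (λ v → adj G u v ∧ does (Data.Nat._>?_ (occ v w) 0)) (allFin n)
  where import Data.Nat

Decomp : ∀ {n} (G : SimpleGraph n) (u : Fin n) (w : Word n) →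
         Vec (Word n) (length (Nbrs G u w)) → Set
Decomp {n} G u w ws =
  (w ∼[ G ] (concat (toList ws) ++ [ u ]))
  × (∀ i → NonEmpty (Vec.lookup ws i) →
       ∀ v → InIA G (Vec.lookup ws i) v ⇔ (v ≡ lookup (Nbrs G u w) i))
  × (∀ i j → i < j → occ (lookup (Nbrs G u w) i) (Vec.lookup ws j) ≡ 0)

module Submission where

-- For a letter t, the letters of a word L that must stay to the left of some
-- occurrence of t (the past of the t's in the heap of L) form a factor
-- front t L with L ∼ front t L ++ back t L; up to ∼ it is the unique
-- factorisation L ∼ A ++ B with t ∉ B and IA(A) ⊆ {t}. It is computed by
-- scanning L from the right, and it respects ∼ because scanning two
-- independent letters in either order gives equivalent results. Peeling off
-- the fronts for u₁ < ⋯ < u_d in turn from w = w′u gives w₁, …, w_d and a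
-- remainder r. The remainder is empty: its last letter would commute past
-- w₁ ⋯ w_d, so either it commutes with u and lies in IA(w) = {u}, or it is a
-- neighbour of u occurring in w, i.e. some u_i, which was peeled off.

open import Defs hiding (sym)
open import Data.Nat using (ℕ; suc; _+_; _>_; _>?_; s≤s; z≤n)
open import Data.Nat.Properties using (+-comm; suc-injective)
open import Data.Fin using (Fin; _<_)
import Data.Fin as Fin
open import Data.Fin.Properties using (_≟_)
open import Data.Bool using (Bool; true; false; T; _∨_; _∧_)
open import Data.Bool.Properties using (∨-comm; ∨-assoc; ∨-conicalˡ; ∨-conicalʳ; T-∧)
open import Data.Bool.ListAction using (any)
open import Data.List using (List; []; _∷_; _++_; [_]; length; concat; allFin; filterᵇ; initLast; _∷ʳ′_)
open import Data.List.Properties using (++-assoc; ++-identityʳ; ++-conicalʳ; length-++; filter-++)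
open import Data.List.Membership.Propositional using (_∈_; _∉_)
open import Data.List.Membership.Propositional.Properties
  using (∈-allFin; ∈-++⁺ˡ; ∈-++⁺ʳ; ∈-filter⁺; ∈-filter⁻)
open import Data.List.Relation.Unary.Any using (here; there)
open import Data.Vec using (Vec; lookup; toList)
import Data.Vec as Vec
import Data.List as List
open import Data.Product using (Σ; _×_; _,_; proj₁; proj₂)
open import Data.Product.Relation.Binary.Pointwise.NonDependent using (Pointwise)
open import Data.Sum using (_⊎_; inj₁; inj₂)
open import Data.Empty using (⊥-elim)
open import Function using (_∘_)
open import Function.Bundles using (_⇔_; mk⇔; Equivalence)
open import Relation.Nullary using (yes; no; does)
open import Relation.Nullary.Decidable using (T?)
open import Relation.Binary.Bundles using (Setoid)
import Relation.Binary.Reasoning.Setoid as SetoidReasoning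
open import Relation.Binary.PropositionalEquality
  using (_≡_; _≢_; refl; sym; trans; cong; cong₂; subst)

occ-++ : ∀ {n} (v : Fin n) xs ys → occ v (xs ++ ys) ≡ occ v xs + occ v ys
occ-++ v xs ys =
  trans (cong length (filter-++ (T? ∘ λ x → does (v ≟ x)) xs ys)) (length-++ (filterᵇ _ xs))

occ-[self] : ∀ {n} (v : Fin n) → occ v [ v ] ≡ 1
occ-[self] v with v ≟ v
... | yes _ = refl
... | no v≢v = ⊥-elim (v≢v refl)

occ-∷ʳ-self : ∀ {n} (v : Fin n) xs → occ v (xs ++ [ v ]) ≡ suc (occ v xs)
occ-∷ʳ-self v xs =
  trans (occ-++ v xs [ v ]) (trans (cong (occ v xs +_) (occ-[self] v)) (+-comm (occ v xs) 1))

∈⇒occ>0 : ∀ {n} {v : Fin n} {xs} → v ∈ xs → occ v xs > 0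
∈⇒occ>0 {v = v} (here refl) with v ≟ v
... | yes _ = s≤s z≤n
... | no v≢v = ⊥-elim (v≢v refl)
∈⇒occ>0 {v = v} {x ∷ _} (there v∈xs) with v ≟ x
... | yes _ = s≤s z≤n
... | no _ = ∈⇒occ>0 v∈xs

∉⇒occ≡0 : ∀ {n} {v : Fin n} {xs} → v ∉ xs → occ v xs ≡ 0
∉⇒occ≡0 {xs = []} _ = refl
∉⇒occ≡0 {v = v} {x ∷ xs} v∉ with v ≟ x
... | yes refl = ⊥-elim (v∉ (here refl))
... | no _ = ∉⇒occ≡0 (v∉ ∘ there)

>0⇒T : ∀ {m} → m > 0 → T (does (m >? 0))
>0⇒T {suc _} _ = _

occ≡0⇒∉ : ∀ {n} {v : Fin n} {xs} → occ v xs ≡ 0 → v ∉ xs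
occ≡0⇒∉ occ≡0 v∈ with () ← subst (_> 0) occ≡0 (∈⇒occ>0 v∈)

occ-concat≡0 : ∀ {n k} (v : Fin n) (ws : Vec (Word n) k) →
  (∀ j → occ v (lookup ws j) ≡ 0) → occ v (concat (toList ws)) ≡ 0
occ-concat≡0 v Vec.[] _ = refl
occ-concat≡0 v (x Vec.∷ ws) occ≡0
  rewrite occ-++ v x (concat (toList ws)) | occ≡0 Fin.zero =
  occ-concat≡0 v ws (occ≡0 ∘ Fin.suc)

module _ {n : ℕ} (G : SimpleGraph n) where

  infix 4 _∼_ _≋_

  _∼_ : Word n → Word n → Set
  xs ∼ ys = xs ∼[ G ] ys

  ∼-setoid : Setoid _ _
  ∼-setoid = record
    { Carrier = Word n
    ; _≈_ = _∼_
    ; isEquivalence = record { refl = ∼refl ; sym = ∼sym ; trans = ∼trans }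
    }

  open SetoidReasoning ∼-setoid

  ∼-reflexive : ∀ {xs ys} → xs ≡ ys → xs ∼ ys
  ∼-reflexive refl = ∼refl

  ∼-prep : ∀ x {xs ys} → xs ∼ ys → x ∷ xs ∼ x ∷ ys
  ∼-prep x ∼refl = ∼refl
  ∼-prep x (∼sym e) = ∼sym (∼-prep x e)
  ∼-prep x (∼trans e f) = ∼trans (∼-prep x e) (∼-prep x f)
  ∼-prep x (∼swap p q a b a≢b a≁b) = ∼swap (x ∷ p) q a b a≢b a≁b

  ∼-++ˡ : ∀ zs {xs ys} → xs ∼ ys → zs ++ xs ∼ zs ++ ys
  ∼-++ˡ [] e = e
  ∼-++ˡ (z ∷ zs) e = ∼-prep z (∼-++ˡ zs e)

  ∼-++ʳ : ∀ zs {xs ys} → xs ∼ ys → xs ++ zs ∼ ys ++ zs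
  ∼-++ʳ zs ∼refl = ∼refl
  ∼-++ʳ zs (∼sym e) = ∼sym (∼-++ʳ zs e)
  ∼-++ʳ zs (∼trans e f) = ∼trans (∼-++ʳ zs e) (∼-++ʳ zs f)
  ∼-++ʳ zs (∼swap p q a b a≢b a≁b) = begin
    (p ++ a ∷ b ∷ q) ++ zs  ≡⟨ ++-assoc p (a ∷ b ∷ q) zs ⟩
    p ++ a ∷ b ∷ q ++ zs    ≈⟨ ∼swap p (q ++ zs) a b a≢b a≁b ⟩
    p ++ b ∷ a ∷ q ++ zs    ≡⟨ ++-assoc p (b ∷ a ∷ q) zs ⟨
    (p ++ b ∷ a ∷ q) ++ zs  ∎

  ∼-length : ∀ {xs ys} → xs ∼ ys → length xs ≡ length ys
  ∼-length ∼refl = refl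
  ∼-length (∼sym e) = sym (∼-length e)
  ∼-length (∼trans e f) = trans (∼-length e) (∼-length f)
  ∼-length (∼swap p q a b _ _) = trans (length-++ p) (sym (length-++ p))

  []∼⇒≡[] : ∀ {xs} → [] ∼ xs → xs ≡ []
  []∼⇒≡[] {[]} _ = refl
  []∼⇒≡[] {_ ∷ _} e with () ← ∼-length e

  ∼-any : ∀ (f : Fin n → Bool) {xs ys} → xs ∼ ys → any f xs ≡ any f ys
  ∼-any f ∼refl = refl
  ∼-any f (∼sym e) = sym (∼-any f e)
  ∼-any f (∼trans e e′) = trans (∼-any f e) (∼-any f e′)
  ∼-any f (∼swap p q a b _ _) = go p
    where
    go : ∀ p → any f (p ++ a ∷ b ∷ q) ≡ any f (p ++ b ∷ a ∷ q)
    go [] = trans (sym (∨-assoc (f a) (f b) _))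
              (trans (cong (_∨ any f q) (∨-comm (f a) (f b))) (∨-assoc (f b) (f a) _))
    go (x ∷ p) = cong (f x ∨_) (go p)

  IA⊆ : Word n → Fin n → Set
  IA⊆ A t = NonEmpty A → ∀ v → InIA G A v → v ≡ t

  dependent : Fin n → Fin n → Bool
  dependent x y = does (x ≟ y) ∨ adj G x y

  ¬dependent⇒swappable : ∀ x y → dependent x y ≡ false → x ≢ y × adj G x y ≡ false
  ¬dependent⇒swappable x y indep with x ≟ y
  ... | yes _ with () ← indep
  ... | no x≢y = x≢y , indep

  ∼-moveʳ : ∀ x as bs → any (dependent x) as ≡ false → x ∷ as ++ bs ∼ as ++ x ∷ bs
  ∼-moveʳ x [] bs _ = ∼refl
  ∼-moveʳ x (a ∷ as) bs indep
    with ¬dependent⇒swappable x a (∨-conicalˡ _ _ indep)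
  ... | x≢a , x≁a =
    ∼trans (∼swap [] (as ++ bs) x a x≢a x≁a) (∼-prep a (∼-moveʳ x as bs (∨-conicalʳ _ _ indep)))

  _≋_ : Word n × Word n → Word n × Word n → Set
  _≋_ = Pointwise _∼_ _∼_

  joins : Fin n → Fin n → Word n → Bool
  joins t x front = does (x ≟ t) ∨ any (dependent x) front

  place : Bool → Fin n → Word n × Word n → Word n × Word n
  place true x (as , bs) = x ∷ as , bs
  place false x (as , bs) = as , x ∷ bs

  push : Fin n → Fin n → Word n × Word n → Word n × Word n
  push t x P = place (joins t x (proj₁ P)) x P

  split : Fin n → Word n → Word n × Word n
  split t [] = [] , []
  split t (x ∷ xs) = push t x (split t xs)

  front back : Fin n → Word n → Word n
  front t L = proj₁ (split t L)
  back t L = proj₂ (split t L)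

  split-∼ : ∀ t L → L ∼ front t L ++ back t L
  split-∼ t [] = ∼refl
  split-∼ t (x ∷ xs) with split t xs | split-∼ t xs
  ... | as , bs | xs∼ with joins t x as in eq
  ... | true = ∼-prep x xs∼
  ... | false = ∼trans (∼-prep x xs∼) (∼-moveʳ x as bs (∨-conicalʳ (does (x ≟ t)) _ eq))

  split-fresh : ∀ t {B} → t ∉ B → split t B ≡ ([] , B)
  split-fresh t {[]} _ = refl
  split-fresh t {x ∷ B} t∉ rewrite split-fresh t (t∉ ∘ there) with x ≟ t
  ... | yes refl = ⊥-elim (t∉ (here refl))
  ... | no _ = refl

  split-++-fresh : ∀ t A {B} → t ∉ B → split t (A ++ B) ≡ (front t A , back t A ++ B)
  split-++-fresh t [] t∉ = split-fresh t t∉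
  split-++-fresh t (x ∷ A) {B} t∉ rewrite split-++-fresh t A t∉
    with joins t x (front t A)
  ... | true = refl
  ... | false = refl

  joins-skip : ∀ t {a b} as → a ≢ b → adj G a b ≡ false → joins t a (b ∷ as) ≡ joins t a as
  joins-skip t {a} {b} as a≢b a≁b with a ≟ b
  ... | yes a≡b = ⊥-elim (a≢b a≡b)
  ... | no _ rewrite a≁b = refl

  push-swap : ∀ t {a b} P → a ≢ b → adj G a b ≡ false →
    push t a (push t b P) ≋ push t b (push t a P)
  push-swap t {a} {b} (as , bs) a≢b a≁b
    with b≢a ← a≢b ∘ sym | b≁a ← trans (SimpleGraph.sym G b a) a≁b
    with joins t b as in jb | joins t a as in ja
  ... | true | true rewrite joins-skip t as a≢b a≁b | ja | joins-skip t as b≢a b≁a | jb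
    = ∼swap [] as a b a≢b a≁b , ∼refl
  ... | true | false rewrite joins-skip t as a≢b a≁b | ja | jb = ∼refl , ∼refl
  ... | false | true rewrite joins-skip t as b≢a b≁a | ja | jb = ∼refl , ∼refl
  ... | false | false rewrite ja | jb = ∼refl , ∼swap [] bs a b a≢b a≁b

  push-cong : ∀ t x {P Q} → P ≋ Q → push t x P ≋ push t x Q
  push-cong t x {P} {Q} (as∼ , bs∼)
    rewrite cong (does (x ≟ t) ∨_) (∼-any (dependent x) as∼)
    with joins t x (proj₁ Q)
  ... | true = ∼-prep x as∼ , bs∼
  ... | false = as∼ , ∼-prep x bs∼

  split-++ˡ-cong : ∀ t p {X Y} → split t X ≋ split t Y → split t (p ++ X) ≋ split t (p ++ Y)
  split-++ˡ-cong t [] e = e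
  split-++ˡ-cong t (x ∷ p) e = push-cong t x (split-++ˡ-cong t p e)

  split-cong : ∀ t {A B} → A ∼ B → split t A ≋ split t B
  split-cong t ∼refl = ∼refl , ∼refl
  split-cong t (∼sym e) with split-cong t e
  ... | e₁ , e₂ = ∼sym e₁ , ∼sym e₂
  split-cong t (∼trans e f) with split-cong t e | split-cong t f
  ... | e₁ , e₂ | f₁ , f₂ = ∼trans e₁ f₁ , ∼trans e₂ f₂
  split-cong t (∼swap p q a b a≢b a≁b) = split-++ˡ-cong t p (push-swap t (split t q) a≢b a≁b)

  split-front : ∀ t L → split t (front t L) ≡ (front t L , [])
  split-front t [] = refl
  split-front t (x ∷ xs) with split t xs | split-front t xs
  ... | as , _ | ih with joins t x as in eq
  ... | true rewrite ih | eq = refl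
  ... | false = ih

  front-ends-in : ∀ t L → front t L ≡ [] ⊎ Σ (Word n) λ p → front t L ≡ p ++ [ t ]
  front-ends-in t [] = inj₁ refl
  front-ends-in t (x ∷ xs) with split t xs | front-ends-in t xs
  ... | as , _ | ih with joins t x as in eq
  ... | false = ih
  ... | true with ih
  ...   | inj₂ (p , refl) = inj₂ (x ∷ p , refl)
  ...   | inj₁ refl with x ≟ t
  ...     | yes refl = inj₂ ([] , refl)
  ...     | no _ with () ← eq

  ∈-front : ∀ t L {y} → y ∈ front t L → y ∈ L
  ∈-front t (x ∷ xs) y∈ with split t xs | ∈-front t xs
  ... | as , _ | ih with joins t x as
  ... | false = there (ih y∈)
  ∈-front t (x ∷ xs) (here refl) | _ | _ | true = here refl
  ∈-front t (x ∷ xs) (there y∈) | _ | ih | true = there (ih y∈)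

  ∈-back : ∀ t L {y} → y ∈ back t L → y ∈ L × y ≢ t
  ∈-back t (x ∷ xs) y∈ with split t xs | ∈-back t xs
  ... | as , _ | ih with joins t x as in eq
  ... | true = let y∈xs , y≢t = ih y∈ in there y∈xs , y≢t
  ∈-back t (x ∷ xs) (there y∈) | _ | ih | false = let y∈xs , y≢t = ih y∈ in there y∈xs , y≢t
  ∈-back t (x ∷ xs) (here refl) | _ | _ | false with x ≟ t
  ... | no x≢t = here refl , x≢t
  ... | yes _ with () ← eq

  front-IA : ∀ t L → NonEmpty (front t L) → ∀ v → InIA G (front t L) v ⇔ (v ≡ t)
  front-IA t L front≢[] v = mk⇔ to from
    where
    from : v ≡ t → InIA G (front t L) v
    from refl with front-ends-in t L
    ... | inj₁ front≡[] = ⊥-elim (front≢[] front≡[])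
    ... | inj₂ (p , front≡) = p , ∼-reflexive front≡

    -- If v ≠ t were initial, the back of front t L (which is empty) would end in v.
    to : InIA G (front t L) v → v ≡ t
    to (p , front∼) with v ≟ t
    ... | yes v≡t = v≡t
    ... | no v≢t with () ← ++-conicalʳ (back t p) [ v ] ([]∼⇒≡[] (begin
      []                         ≡⟨ cong proj₂ (split-front t L) ⟨
      back t (front t L)         ≈⟨ proj₂ (split-cong t front∼) ⟩
      back t (p ++ [ v ])        ≡⟨ cong proj₂ (split-++-fresh t p λ { (here t≡v) → v≢t (sym t≡v) }) ⟩
      back t p ++ [ v ]          ∎))

  back≡[] : ∀ t A → IA⊆ A t → back t A ≡ []
  back≡[] t [] _ = refl
  back≡[] t A@(_ ∷ _) IA⊆t with back t A | split-∼ t A | ∈-back t A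
  ... | bs | A∼ | ∈bs with initLast bs
  ... | [] = refl
  ... | bs′ ∷ʳ′ z = ⊥-elim (z≢t (IA⊆t (λ ()) z (front t A ++ bs′ , A∼′)))
    where
    z≢t : z ≢ t
    z≢t = proj₂ (∈bs (∈-++⁺ʳ bs′ (here refl)))
    A∼′ : A ∼ (front t A ++ bs′) ++ [ z ]
    A∼′ = ∼trans A∼ (∼-reflexive (sym (++-assoc (front t A) bs′ [ z ])))

  split-unique : ∀ t {L} A B → L ∼ A ++ B → t ∉ B → IA⊆ A t → front t L ∼ A × back t L ∼ B
  split-unique t {L} A B L∼ t∉B IA⊆t = front∼ , back∼
    where
    split-L : split t L ≋ split t (A ++ B)
    split-L = split-cong t L∼
    split-A++B : split t (A ++ B) ≡ (front t A , back t A ++ B)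
    split-A++B = split-++-fresh t A t∉B
    front∼ : front t L ∼ A
    front∼ = begin
      front t L                ≈⟨ proj₁ split-L ⟩
      front t (A ++ B)         ≡⟨ cong proj₁ split-A++B ⟩
      front t A                ≡⟨ ++-identityʳ (front t A) ⟨
      front t A ++ []          ≡⟨ cong (front t A ++_) (back≡[] t A IA⊆t) ⟨
      front t A ++ back t A    ≈⟨ split-∼ t A ⟨
      A                        ∎
    back∼ : back t L ∼ B
    back∼ = begin
      back t L                 ≈⟨ proj₂ split-L ⟩
      back t (A ++ B)          ≡⟨ cong proj₂ split-A++B ⟩
      back t A ++ B            ≡⟨ cong (_++ B) (back≡[] t A IA⊆t) ⟩
      B                        ∎

  blocks : (ts : List (Fin n)) → Word n → Vec (Word n) (length ts)
  blocks [] L = Vec.[]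
  blocks (t ∷ ts) L = front t L Vec.∷ blocks ts (back t L)

  rest : List (Fin n) → Word n → Word n
  rest [] L = L
  rest (t ∷ ts) L = rest ts (back t L)

  blocks-∼ : ∀ ts L → L ∼ concat (toList (blocks ts L)) ++ rest ts L
  blocks-∼ [] L = ∼refl
  blocks-∼ (t ∷ ts) L = begin
    L                                                    ≈⟨ split-∼ t L ⟩
    front t L ++ back t L                                ≈⟨ ∼-++ˡ (front t L) (blocks-∼ ts (back t L)) ⟩
    front t L ++ concat (toList (blocks ts (back t L))) ++ rest ts (back t L)
                                                         ≡⟨ ++-assoc (front t L) _ (rest ts (back t L)) ⟨
    (front t L ++ concat (toList (blocks ts (back t L)))) ++ rest ts (back t L)  ∎

  ∈-rest : ∀ ts L {y} → y ∈ rest ts L → y ∈ L × y ∉ ts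
  ∈-rest [] L y∈ = y∈ , λ ()
  ∈-rest (t ∷ ts) L y∈ with ∈-rest ts (back t L) y∈
  ... | y∈back , y∉ts with ∈-back t L y∈back
  ...   | y∈L , y≢t = y∈L , λ { (here y≡t) → y≢t y≡t ; (there y∈ts) → y∉ts y∈ts }

  ∈-blocks : ∀ ts L j {y} → y ∈ lookup (blocks ts L) j → y ∈ L
  ∈-blocks (t ∷ ts) L Fin.zero y∈ = ∈-front t L y∈
  ∈-blocks (t ∷ ts) L (Fin.suc j) y∈ = proj₁ (∈-back t L (∈-blocks ts (back t L) j y∈))

  blocks-IA : ∀ ts L i → NonEmpty (lookup (blocks ts L) i) →
    ∀ v → InIA G (lookup (blocks ts L) i) v ⇔ (v ≡ List.lookup ts i)
  blocks-IA (t ∷ ts) L Fin.zero = front-IA t L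
  blocks-IA (t ∷ ts) L (Fin.suc i) = blocks-IA ts (back t L) i

  blocks-occ : ∀ ts L i j → i < j → occ (List.lookup ts i) (lookup (blocks ts L) j) ≡ 0
  blocks-occ (t ∷ ts) L Fin.zero (Fin.suc j) _ =
    ∉⇒occ≡0 λ t∈ → proj₂ (∈-back t L (∈-blocks ts (back t L) j t∈)) refl
  blocks-occ (t ∷ ts) L (Fin.suc i) (Fin.suc j) (s≤s i<j) =
    blocks-occ ts (back t L) i j i<j

  blocks-∷ʳ : ∀ ts L {u} → u ∉ ts →
    blocks ts (L ++ [ u ]) ≡ blocks ts L × rest ts (L ++ [ u ]) ≡ rest ts L ++ [ u ]
  blocks-∷ʳ [] L _ = refl , refl
  blocks-∷ʳ (t ∷ ts) L {u} u∉
    rewrite split-++-fresh t L {[ u ]} (λ { (here refl) → u∉ (here refl) })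
    with blocks-∷ʳ ts (back t L) (u∉ ∘ there)
  ... | blocks≡ , rest≡ rewrite blocks≡ | rest≡ = refl , refl

  blocks-unique : ∀ ts L (ws : Vec (Word n) (length ts)) B →
    L ∼ concat (toList ws) ++ B →
    (∀ {t} → t ∈ ts → t ∉ B) →
    (∀ i → IA⊆ (lookup ws i) (List.lookup ts i)) →
    (∀ i j → i < j → occ (List.lookup ts i) (lookup ws j) ≡ 0) →
    ∀ i → lookup (blocks ts L) i ∼ lookup ws i
  blocks-unique (t ∷ ts) L (A Vec.∷ ws) B L∼ ts∉B IA⊆ts occ≡0 = λ where
      Fin.zero → proj₁ split-L
      (Fin.suc i) → blocks-unique ts (back t L) ws B (proj₂ split-L) (ts∉B ∘ there)
        (IA⊆ts ∘ Fin.suc) (λ i j i<j → occ≡0 (Fin.suc i) (Fin.suc j) (s≤s i<j)) i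
    where
    t∉ : t ∉ concat (toList ws) ++ B
    t∉ = occ≡0⇒∉ (trans (occ-++ t (concat (toList ws)) B)
      (cong₂ _+_ (occ-concat≡0 t ws λ j → occ≡0 Fin.zero (Fin.suc j) (s≤s z≤n))
                 (∉⇒occ≡0 (ts∉B (here refl)))))
    split-L : front t L ∼ A × back t L ∼ concat (toList ws) ++ B
    split-L = split-unique t A (concat (toList ws) ++ B)
      (∼trans L∼ (∼-reflexive (++-assoc A (concat (toList ws)) B))) t∉ (IA⊆ts Fin.zero)

module _ {n : ℕ} (G : SimpleGraph n) (u : Fin n) (w′ : Word n) where

  open SetoidReasoning (∼-setoid G)

  private
    w : Word n
    w = w′ ++ [ u ]

    ts : List (Fin n)
    ts = Nbrs G u w

    isNbr : Fin n → Bool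
    isNbr v = adj G u v ∧ does (occ v w >? 0)

  u∉Nbrs : u ∉ ts
  u∉Nbrs u∈ =
    subst T (irrefl G u) (proj₁ (Equivalence.to T-∧ (proj₂ (∈-filter⁻ (T? ∘ isNbr) {xs = allFin n} u∈))))

  ∈-Nbrs : ∀ {v} → T (adj G u v) → v ∈ w → v ∈ ts
  ∈-Nbrs {v} u~v v∈ =
    ∈-filter⁺ (T? ∘ isNbr) (∈-allFin v) (Equivalence.from T-∧ (u~v , >0⇒T (∈⇒occ>0 v∈)))

  rest-Nbrs≡[] : (∀ v → InIA G w v → v ≡ u) → u ∉ w′ → rest G ts w′ ≡ []
  rest-Nbrs≡[] IA⊆u u∉w′ with rest G ts w′ | blocks-∼ G ts w′ | ∈-rest G ts w′
  ... | r | w′∼ | ∈r with initLast r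
  ... | [] = refl
  ... | r′ ∷ʳ′ z with ∈r (∈-++⁺ʳ r′ (here refl))
  ...   | z∈w′ , z∉ts with adj G z u in z~u
  ...     | true =
    ⊥-elim (z∉ts (∈-Nbrs (subst T (sym (trans (SimpleGraph.sym G u z) z~u)) _) (∈-++⁺ˡ z∈w′)))
  ...     | false = ⊥-elim (z≢u (IA⊆u z ((C ++ r′ ++ [ u ]) , (begin
    w′ ++ [ u ]                 ≈⟨ ∼-++ʳ G [ u ] w′∼ ⟩
    (C ++ r′ ++ [ z ]) ++ [ u ] ≡⟨ ++-assoc C (r′ ++ [ z ]) [ u ] ⟩
    C ++ (r′ ++ [ z ]) ++ [ u ] ≡⟨ cong (C ++_) (++-assoc r′ [ z ] [ u ]) ⟩
    C ++ r′ ++ z ∷ u ∷ []       ≡⟨ ++-assoc C r′ (z ∷ u ∷ []) ⟨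
    (C ++ r′) ++ z ∷ u ∷ []     ≈⟨ ∼swap (C ++ r′) [] z u z≢u z~u ⟩
    (C ++ r′) ++ u ∷ z ∷ []     ≡⟨ ++-assoc C r′ (u ∷ z ∷ []) ⟩
    C ++ r′ ++ u ∷ z ∷ []       ≡⟨ cong (C ++_) (++-assoc r′ [ u ] [ z ]) ⟨
    C ++ (r′ ++ [ u ]) ++ [ z ] ≡⟨ ++-assoc C (r′ ++ [ u ]) [ z ] ⟨
    (C ++ r′ ++ [ u ]) ++ [ z ] ∎))))
    where
    C : Word n
    C = concat (toList (blocks G ts w′))
    z≢u : z ≢ u
    z≢u refl = u∉w′ z∈w′

  blocks-Decomp : (∀ v → InIA G w v → v ≡ u) → u ∉ w′ → Decomp G u w (blocks G ts w′)
  blocks-Decomp IA⊆u u∉w′ = w∼ , blocks-IA G ts w′ , blocks-occ G ts w′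
    where
    C : Word n
    C = concat (toList (blocks G ts w′))
    w∼ : w ∼[ G ] (C ++ [ u ])
    w∼ = begin
      w′ ++ [ u ]                   ≈⟨ ∼-++ʳ G [ u ] (blocks-∼ G ts w′) ⟩
      (C ++ rest G ts w′) ++ [ u ]  ≡⟨ cong (λ r → (C ++ r) ++ [ u ]) (rest-Nbrs≡[] IA⊆u u∉w′) ⟩
      (C ++ []) ++ [ u ]            ≡⟨ cong (_++ [ u ]) (++-identityʳ C) ⟩
      C ++ [ u ]                    ∎

  blocks-Decomp-unique : ∀ ws → Decomp G u w ws → ∀ i → lookup (blocks G ts w′) i ∼[ G ] lookup ws i
  blocks-Decomp-unique ws (w∼ , IA≡ , occ≡0) i =
    subst (λ vs → lookup vs i ∼[ G ] lookup ws i) (proj₁ (blocks-∷ʳ G ts w′ u∉Nbrs))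
      (blocks-unique G ts w ws [ u ] w∼ (λ t∈ → λ { (here refl) → u∉Nbrs t∈ })
        (λ i w≢[] v → Equivalence.to (IA≡ i w≢[] v)) occ≡0 i)

proposition2p1 : ∀ {n} (G : SimpleGraph n) (u : Fin n) (w : Word n) →
    InPu G u w → occ u w ≡ 1 →
    Σ (Vec (Word n) (length (Nbrs G u w))) λ ws →
      Decomp G u w ws ×
      (∀ ws′ → Decomp G u w ws′ → ∀ i → lookup ws i ∼[ G ] lookup ws′ i)
proposition2p1 G u w (w≢[] , IA⊆u) occ≡1 with initLast w
... | [] = ⊥-elim (w≢[] refl)
... | w′ ∷ʳ′ x with IA⊆u x (w′ , ∼refl)
... | refl = blocks G (Nbrs G u (w′ ++ [ u ])) w′
           , blocks-Decomp G u w′ IA⊆u u∉w′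
           , blocks-Decomp-unique G u w′
  where
  u∉w′ : u ∉ w′
  u∉w′ = occ≡0⇒∉ (suc-injective (trans (sym (occ-∷ʳ-self u w′)) occ≡1))
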